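{- Let $r,s\ge1$ and $p_1,\dots,p_r,q_1,\dots,q_s$ be positive integers with $\{p_i\}\cap\{q_j\}=\emptyset$, $q_s=1$ and $\sum_ip_i=\sum_jq_j=L$; put $n=r+s-1$. Let ${\bf e}_0,\dots,{\bf e}_n\in\mathbb Z^n$, $G$, $H$, depth, primitivity and the vectors ${\bf u}_\mu$ be as in the context, and let $\beta=\bigcup_{j=1}^s\{\tfrac{i}{q_j}:1\le i\le q_j\}$ (a multiset of $L$ elements), listed as $0=b_0<b_1\le b_2\le\cdots\le b_L\,(=1)$, with $b_0=0\notin\beta$ appended. Then: 1) for each $b\in\beta$, ${\bf u}_b\in G$ is primitive; 2) if $b_i\ne b_j$ are elements of $\beta$, then ${\bf u}_{b_i}\neq{\bf u}_{b_j}$; 3) if $1\le i\le L$ and $b_{i-1}<b_i$, and $S_i=\{1\le j\le s-1: b_iq_j\in\mathbb Z\}$, then ${\bf u}_{b_i}+\sum_{j\in S_i}{\bf e}_{r-1+j}\in{\bf u}_{b_{i-1}}+H$.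
   Context: ${\bf e}_0=[1,0,\dots,0]$; for $1\le i\le n-1$, ${\bf e}_i$ has first coordinate $1$, $(i+1)$-st coordinate $1$ and other coordinates $0$; ${\bf e}_n=[1,p_1,\dots,p_{r-1},-q_1,\dots,-q_{s-1}]$. $G=\{\sum_{i=0}^nc_i{\bf e}_i:c_i\in\mathbb R_{\ge0}\}\cap\mathbb Z^n$ and $H=\{\sum_{i=0}^{n-1}a_i{\bf e}_i:a_i\in\mathbb Z_{\ge0}\}$. The depth of a vector is the sum of its negative entries; an element of $G$ is primitive if its depth is negative. For $\{x\}=x-\lfloor x\rfloor$ and rational $\mu\in[0,1]$, $${\bf u}_\mu=\mu{\bf e}_n+\{ -\mu p_r\}{\bf e}_0+\sum_{i=1}^{r-1}\{ -\mu p_i\}{\bf e}_i+\sum_{j=1}^{s-1}\{\mu q_j\}{\bf e}_{r-1+j}$$ (so ${\bf u}_0$ is the origin and ${\bf u}_1={\bf e}_n$). -}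

module Defs where

open import Data.Nat as ℕ using (ℕ; zero; suc; _∸_; _<ᵇ_; _≡ᵇ_)
open import Data.Nat.Base using (_≤_; _<_)
open import Data.Integer as ℤ using (ℤ; +_)
open import Data.Rational as ℚ using (ℚ; mkℚ; 0ℚ; 1ℚ; floor)
import Data.Nat.Coprimality as Cop
open import Data.Bool using (Bool; true; false; if_then_else_)
open import Data.Fin using (Fin; toℕ)
open import Data.List using (List; applyUpTo; concat)
open import Data.Product using (Σ; _,_)
open import Relation.Nullary using (Dec; yes; no)
open import Relation.Binary.PropositionalEquality using (_≡_; refl)

-- Conventions: the sequences p_1..p_r and q_1..q_s are given as functions
-- ℕ → ℕ, 1-indexed (values outside 1..r resp. 1..s are irrelevant).
-- Vectors of ℤ^n (⊆ ℚ^n) are functions Fin n → ℚ; coordinates are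
-- 0-indexed, i.e. coordinate t corresponds to the (t+1)-st coordinate.

Vecℚ : ℕ → Set
Vecℚ n = Fin n → ℚ

_+ᵥ_ : ∀ {n} → Vecℚ n → Vecℚ n → Vecℚ n
(v +ᵥ w) k = v k ℚ.+ w k

_·ᵥ_ : ∀ {n} → ℚ → Vecℚ n → Vecℚ n
(c ·ᵥ v) k = c ℚ.* v k

0ᵥ : ∀ {n} → Vecℚ n
0ᵥ k = 0ℚ

Σℚ : ℕ → (ℕ → ℚ) → ℚ
Σℚ zero f = 0ℚ
Σℚ (suc m) f = Σℚ m f ℚ.+ f m

Σᵥ : ∀ {n} → ℕ → (ℕ → Vecℚ n) → Vecℚ n
Σᵥ m f k = Σℚ m (λ i → f i k)

ΣFin : ∀ n → (Fin n → ℚ) → ℚ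
ΣFin zero f = 0ℚ
ΣFin (suc n) f = f Fin.zero ℚ.+ ΣFin n (λ k → f (Fin.suc k))
  where import Data.Fin as Fin

fromℤ : ℤ → ℚ
fromℤ z = mkℚ z 0 (Cop.sym (Cop.1-coprimeTo ℤ.∣ z ∣))

ℕℚ : ℕ → ℚ
ℕℚ m = fromℤ (+ m)

frac : ℚ → ℚ
frac x = x ℚ.- fromℤ (floor x)

-- total division on naturals: i / d (taken to be 0 if d = 0; only used with d > 0)
divℚ : ℕ → ℕ → ℚ
divℚ i zero = 0ℚ
divℚ i (suc d) = (+ i) ℚ./ suc d

IsInt : ℚ → Set
IsInt x = Σ ℤ (λ z → x ≡ fromℤ z)

isInt? : (x : ℚ) → Dec (IsInt x)
isInt? (mkℚ n zero c) = yes (n , refl)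
isInt? (mkℚ n (suc d) c) = no λ { (z , ()) }

module Setup (r s : ℕ) (p q : ℕ → ℕ) where

  n : ℕ
  n = r ℕ.+ s ∸ 1

  -- the vectors e_0, ..., e_n  (e i for i > n is junk and never used)
  e : ℕ → Vecℚ n
  e zero k = if toℕ k ≡ᵇ 0 then 1ℚ else 0ℚ
  e (suc i) k with suc i ≡ᵇ n
  ... | false = if toℕ k ≡ᵇ 0 then 1ℚ else (if toℕ k ≡ᵇ suc i then 1ℚ else 0ℚ)
  ... | true  = if toℕ k ≡ᵇ 0 then 1ℚ
                else (if toℕ k <ᵇ r then ℕℚ (p (toℕ k))
                      else ℚ.- ℕℚ (q (suc (toℕ k ∸ r))))

  -- membership in G = (real nonnegative cone on e_0..e_n) ∩ ℤ^n
  -- (nonnegative real coefficients may be taken rational since all data is rational)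
  InG : Vecℚ n → Set
  InG v = Σ (ℕ → ℚ) (λ c →
            (∀ i → i ≤ n → 0ℚ ℚ.≤ c i)
          × (∀ k → v k ≡ Σᵥ (suc n) (λ i → c i ·ᵥ e i) k))
        × (∀ k → IsInt (v k))
    where open import Data.Product using (_×_)

  -- v ∈ w + H  where H = ℤ≥0-span of e_0..e_{n-1}
  InTranslateH : Vecℚ n → Vecℚ n → Set
  InTranslateH v w = Σ (ℕ → ℕ) (λ a →
            ∀ k → v k ≡ (w +ᵥ Σᵥ n (λ i → ℕℚ (a i) ·ᵥ e i)) k)

  depth : Vecℚ n → ℚ
  depth v = ΣFin n (λ k → v k ℚ.⊓ 0ℚ)

  Primitive : Vecℚ n → Set
  Primitive v = depth v ℚ.< 0ℚ

  u : ℚ → Vecℚ n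
  u μ = (μ ·ᵥ e n)
     +ᵥ ((frac (ℚ.- (μ ℚ.* ℕℚ (p r))) ·ᵥ e 0)
     +ᵥ (Σᵥ (r ∸ 1) (λ i → frac (ℚ.- (μ ℚ.* ℕℚ (p (suc i)))) ·ᵥ e (suc i))
     +ᵥ  Σᵥ (s ∸ 1) (λ j → frac (μ ℚ.* ℕℚ (q (suc j))) ·ᵥ e (r ∸ 1 ℕ.+ suc j))))

  βlist : List ℚ
  βlist = concat (applyUpTo (λ j → applyUpTo (λ i → divℚ (suc i) (q (suc j))) (q (suc j))) s)

  sumS : ℚ → Vecℚ n
  sumS b = Σᵥ (s ∸ 1) (λ j → if Relation.Nullary.does (isInt? (b ℚ.* ℕℚ (q (suc j))))
                                then e (r ∸ 1 ℕ.+ suc j) else 0ᵥ)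
    where import Relation.Nullary

-- Write u b = Σ c i · e i with c n = b and every other c i a fractional part, hence ≥ 0.
-- Then u b has entry ⌈b p i⌉ in coordinate i (1 ≤ i < r), −⌊b q j⌋ in coordinate r−1+j
-- (1 ≤ j < s), and Σ_{i≤r} ⌈b p i⌉ − Σ_{j<s} ⌊b q j⌋ in coordinate 0, where b drops out because
-- Σ p = Σ q and q s = 1; so u b ∈ G. Each b ∈ β has b q j ∈ ℤ_{>0} for some j < s (for b = 1 this
-- uses s ≥ 2): that coordinate of u b is negative, so u b is primitive, and it is strictly below
-- the same coordinate of u b′ for every b′ < b, which separates them. For consecutive b′ < b in β
-- no multiple of 1/q j lies strictly between them, so ⌊b q j⌋ = ⌊b′ q j⌋ + [b q j ∈ ℤ], and the
-- remaining differences ⌈b p i⌉ − ⌈b′ p i⌉ ≥ 0 are the coefficients of an element of H.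

module Submission where

open import Defs
open import Level using (0ℓ)
open import Data.Bool using (true; false; if_then_else_; T)
open import Data.Bool.Properties using (T-≡)
open import Data.Empty using (⊥; ⊥-elim)
open import Data.Fin using (Fin; toℕ; fromℕ<)
import Data.Fin as Fin
import Data.Fin.Properties as FinP
open import Data.Integer as ℤ using (ℤ; +_; -[1+_])
import Data.Integer.Properties as ℤP
import Data.Integer.DivMod as ℤD
open import Data.Integer.Tactic.RingSolver using () renaming (solve-∀ to ℤ-solve-∀)
open import Data.List using (List; applyUpTo)
open import Data.List.Membership.Propositional using (_∈_)
open import Data.List.Membership.Propositional.Properties
  using (∈-concat⁻′; ∈-concat⁺′; ∈-applyUpTo⁻; ∈-applyUpTo⁺)
open import Data.List.Relation.Binary.Permutation.Propositional using (_↭_; ↭-sym)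
open import Data.List.Relation.Binary.Permutation.Propositional.Properties using (∈-resp-↭)
open import Data.Nat as ℕ using (ℕ; zero; suc; _∸_; _≡ᵇ_; _<ᵇ_; _≤_; _<_; z≤n; s≤s)
import Data.Nat.Properties as ℕP
open import Data.Nat.ListAction using (sum)
open import Data.Product using (∃-syntax; _,_; proj₁; proj₂; _×_)
open import Data.Rational as ℚ using (ℚ; 0ℚ; 1ℚ; floor; ceiling; _+_; _*_; -_; _-_)
import Data.Rational.Properties as ℚP
import Data.Rational.Unnormalised as ℚᵘ
import Data.Rational.Unnormalised.Properties as ℚᵘP
open import Data.Sum using (inj₁; inj₂)
open import Function.Bundles using (Equivalence)
open import Relation.Binary using (tri<; tri≈; tri>)
open import Relation.Binary.PropositionalEquality
open import Relation.Nullary using (¬_; yes; no; does)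
open import Relation.Nullary.Decidable using (dec⇒maybe)
open import Tactic.RingSolver using (solve-∀)
open import Tactic.RingSolver.Core.AlmostCommutativeRing
  using (AlmostCommutativeRing; fromCommutativeRing)

-- The zero test lets the reflective ring solver normalise rational constants.
ℚ-ring : AlmostCommutativeRing 0ℓ 0ℓ
ℚ-ring = fromCommutativeRing ℚP.+-*-commutativeRing (λ x → dec⇒maybe (0ℚ ℚP.≟ x))

fromℤ-+ : ∀ a b → fromℤ a + fromℤ b ≡ fromℤ (a ℤ.+ b)
fromℤ-+ a b = ℚP.toℚᵘ-injective
  (ℚᵘP.≃-trans (ℚP.toℚᵘ-homo-+ (fromℤ a) (fromℤ b)) (ℚᵘ.*≡* (identity a b)))
  where
  identity : ∀ a b → (a ℤ.* + 1 ℤ.+ b ℤ.* + 1) ℤ.* + 1 ≡ (a ℤ.+ b) ℤ.* (+ 1 ℤ.* + 1)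
  identity = ℤ-solve-∀

fromℤ-neg : ∀ a → - fromℤ a ≡ fromℤ (ℤ.- a)
fromℤ-neg (+ zero) = refl
fromℤ-neg (+ suc n) = refl
fromℤ-neg -[1+ n ] = refl

fromℤ-suc : ∀ a → fromℤ (ℤ.suc a) ≡ fromℤ a + 1ℚ
fromℤ-suc a = trans (cong fromℤ (ℤP.+-comm (+ 1) a)) (sym (fromℤ-+ a (+ 1)))

fromℤ-mono-≤ : ∀ {a b} → a ℤ.≤ b → fromℤ a ℚ.≤ fromℤ b
fromℤ-mono-≤ {a} {b} h = ℚ.*≤* (subst₂ ℤ._≤_ (sym (ℤP.*-identityʳ a)) (sym (ℤP.*-identityʳ b)) h)

fromℤ-cancel-≤ : ∀ {a b} → fromℤ a ℚ.≤ fromℤ b → a ℤ.≤ b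
fromℤ-cancel-≤ {a} {b} (ℚ.*≤* h) = subst₂ ℤ._≤_ (ℤP.*-identityʳ a) (ℤP.*-identityʳ b) h

fromℤ-mono-< : ∀ {a b} → a ℤ.< b → fromℤ a ℚ.< fromℤ b
fromℤ-mono-< {a} {b} h = ℚ.*<* (subst₂ ℤ._<_ (sym (ℤP.*-identityʳ a)) (sym (ℤP.*-identityʳ b)) h)

fromℤ-cancel-< : ∀ {a b} → fromℤ a ℚ.< fromℤ b → a ℤ.< b
fromℤ-cancel-< {a} {b} (ℚ.*<* h) = subst₂ ℤ._<_ (ℤP.*-identityʳ a) (ℤP.*-identityʳ b) h

ℕℚ-∣-∣ : ∀ {a b} → a ℤ.≤ b → ℕℚ ℤ.∣ b ℤ.- a ∣ ≡ fromℤ b - fromℤ a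
ℕℚ-∣-∣ {a} {b} a≤b = begin
  fromℤ (+ ℤ.∣ b ℤ.- a ∣)      ≡⟨ cong fromℤ (ℤP.0≤i⇒+∣i∣≡i (ℤP.i≤j⇒0≤j-i a≤b)) ⟩
  fromℤ (b ℤ.+ ℤ.- a)          ≡⟨ sym (fromℤ-+ b (ℤ.- a)) ⟩
  fromℤ b + fromℤ (ℤ.- a)      ≡⟨ cong (_+_ (fromℤ b)) (sym (fromℤ-neg a)) ⟩
  fromℤ b - fromℤ a            ∎
  where open ≡-Reasoning

⌊_⌋ℚ ⌈_⌉ℚ : ℚ → ℚ
⌊ x ⌋ℚ = fromℤ (floor x)
⌈ x ⌉ℚ = fromℤ (ceiling x)

floor≤ : ∀ x → ⌊ x ⌋ℚ ℚ.≤ x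
floor≤ (ℚ.mkℚ n d _) = ℚ.*≤* (subst₂ ℤ._≤_ refl (sym (ℤP.*-identityʳ n))
  (subst ((n ℤ./ + suc d) ℤ.* + suc d ℤ.≤_) (sym (ℤD.a≡a%n+[a/n]*n n (+ suc d)))
    (ℤP.i≤j+i _ (+ (n ℤ.% + suc d)))))

<floor+1 : ∀ x → x ℚ.< fromℤ (ℤ.suc (floor x))
<floor+1 (ℚ.mkℚ n d _) = ℚ.*<* (subst₂ ℤ._<_ (sym (ℤP.*-identityʳ n)) refl
  (subst (ℤ._< ℤ.suc (n ℤ./ D) ℤ.* D) (sym (ℤD.a≡a%n+[a/n]*n n D))
    (subst (+ (n ℤ.% D) ℤ.+ (n ℤ./ D) ℤ.* D ℤ.<_) (identity (n ℤ./ D) D)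
      (ℤP.+-monoˡ-< ((n ℤ./ D) ℤ.* D) (ℤ.+<+ (ℤD.n%d<d n D))))))
  where
  D = + suc d
  identity : ∀ a b → b ℤ.+ a ℤ.* b ≡ (+ 1 ℤ.+ a) ℤ.* b
  identity = ℤ-solve-∀

<suc⇒≤ : ∀ {a b} → a ℤ.< ℤ.suc b → a ℤ.≤ b
<suc⇒≤ {a} {b} h = subst (a ℤ.≤_) (ℤP.pred-suc b) (ℤP.i<j⇒i≤pred[j] h)

floor-greatest : ∀ {m x} → fromℤ m ℚ.≤ x → m ℤ.≤ floor x
floor-greatest {m} {x} h = <suc⇒≤ (fromℤ-cancel-< (ℚP.≤-<-trans h (<floor+1 x)))

floor-< : ∀ {m x} → x ℚ.< fromℤ m → floor x ℤ.< m
floor-< {m} {x} h = fromℤ-cancel-< (ℚP.≤-<-trans (floor≤ x) h)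

floor-fromℤ : ∀ m → floor (fromℤ m) ≡ m
floor-fromℤ m = ℤP.≤-antisym (fromℤ-cancel-≤ (floor≤ (fromℤ m))) (floor-greatest ℚP.≤-refl)

floor-mono : ∀ {x y} → x ℚ.≤ y → floor x ℤ.≤ floor y
floor-mono {x} h = floor-greatest (ℚP.≤-trans (floor≤ x) h)

ceiling-mono : ∀ {x y} → x ℚ.≤ y → ceiling x ℤ.≤ ceiling y
ceiling-mono {record{}} {record{}} h = ℤP.neg-mono-≤ (floor-mono (ℚP.neg-antimono-≤ h))

frac-nonNeg : ∀ x → 0ℚ ℚ.≤ frac x
frac-nonNeg x = subst (ℚ._≤ frac x) (ℚP.+-inverseʳ ⌊ x ⌋ℚ) (ℚP.+-monoˡ-≤ (- ⌊ x ⌋ℚ) (floor≤ x))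

floor<-nonInt : ∀ {x} → ¬ IsInt x → ⌊ x ⌋ℚ ℚ.< x
floor<-nonInt {x} x∉ℤ with ℚP.<-cmp ⌊ x ⌋ℚ x
... | tri< ⌊x⌋<x _ _ = ⌊x⌋<x
... | tri≈ _ ⌊x⌋≡x _ = ⊥-elim (x∉ℤ (floor x , sym ⌊x⌋≡x))
... | tri> _ _ ⌊x⌋>x = ⊥-elim (ℚP.<-irrefl refl (ℚP.<-≤-trans ⌊x⌋>x (floor≤ x)))

frac-neg : ∀ x → frac (- x) ≡ ⌈ x ⌉ℚ - x
frac-neg x@record{} = trans (ℚP.+-comm (- x) (- ⌊ - x ⌋ℚ)) (cong (_- x) (fromℤ-neg (floor (- x))))

floor-of-gap : ∀ {x′ x} T → x′ ℚ.< x → fromℤ T ℚ.< x → x ℚ.≤ fromℤ (ℤ.suc T) →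
               (∀ m → x′ ℚ.< fromℤ m → fromℤ m ℚ.< x → ⊥) → floor x′ ≡ T
floor-of-gap {x′} T x′<x T<x x≤T+1 no-integer = ℤP.≤-antisym
  (<suc⇒≤ (floor-< (ℚP.<-≤-trans x′<x x≤T+1)))
  (floor-greatest (ℚP.≮⇒≥ (λ x′<T → no-integer T x′<T T<x)))

Σℚ-cong : ∀ m {f g : ℕ → ℚ} → (∀ i → i < m → f i ≡ g i) → Σℚ m f ≡ Σℚ m g
Σℚ-cong zero h = refl
Σℚ-cong (suc m) h = cong₂ _+_ (Σℚ-cong m (λ i i<m → h i (ℕP.m<n⇒m<1+n i<m))) (h m ℕP.≤-refl)

Σℚ-zero : ∀ m → Σℚ m (λ _ → 0ℚ) ≡ 0ℚ
Σℚ-zero zero = refl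
Σℚ-zero (suc m) rewrite Σℚ-zero m = refl

Σℚ-+ : ∀ m (f g : ℕ → ℚ) → Σℚ m (λ i → f i + g i) ≡ Σℚ m f + Σℚ m g
Σℚ-+ zero f g = refl
Σℚ-+ (suc m) f g rewrite Σℚ-+ m f g = identity (Σℚ m f) (Σℚ m g) (f m) (g m)
  where
  identity : ∀ a b c d → (a + b) + (c + d) ≡ (a + c) + (b + d)
  identity = solve-∀ ℚ-ring

Σℚ-minus : ∀ m (f g : ℕ → ℚ) → Σℚ m (λ i → f i - g i) ≡ Σℚ m f - Σℚ m g
Σℚ-minus zero f g = refl
Σℚ-minus (suc m) f g rewrite Σℚ-minus m f g = identity (Σℚ m f) (Σℚ m g) (f m) (g m)
  where
  identity : ∀ a b c d → (a - b) + (c - d) ≡ (a + c) - (b + d)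
  identity = solve-∀ ℚ-ring

Σℚ-*ˡ : ∀ m c (f : ℕ → ℚ) → Σℚ m (λ i → c * f i) ≡ c * Σℚ m f
Σℚ-*ˡ zero c f = sym (ℚP.*-zeroʳ c)
Σℚ-*ˡ (suc m) c f rewrite Σℚ-*ˡ m c f = sym (ℚP.*-distribˡ-+ c (Σℚ m f) (f m))

Σℚ-frac : ∀ m b (g : ℕ → ℚ) →
  Σℚ m (λ i → frac (b * g i)) ≡ b * Σℚ m g - Σℚ m (λ i → ⌊ b * g i ⌋ℚ)
Σℚ-frac m b g = trans (Σℚ-minus m (λ i → b * g i) (λ i → ⌊ b * g i ⌋ℚ))
                      (cong (_- Σℚ m (λ i → ⌊ b * g i ⌋ℚ)) (Σℚ-*ˡ m b g))

Σℚ-frac-neg : ∀ m b (g : ℕ → ℚ) →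
  Σℚ m (λ i → frac (- (b * g i))) ≡ Σℚ m (λ i → ⌈ b * g i ⌉ℚ) - b * Σℚ m g
Σℚ-frac-neg m b g = begin
  Σℚ m (λ i → frac (- (b * g i)))     ≡⟨ Σℚ-cong m (λ i _ → frac-neg (b * g i)) ⟩
  Σℚ m (λ i → ⌈ b * g i ⌉ℚ - b * g i) ≡⟨ Σℚ-minus m (λ i → ⌈ b * g i ⌉ℚ) (λ i → b * g i) ⟩
  C - Σℚ m (λ i → b * g i)            ≡⟨ cong (_-_ C) (Σℚ-*ˡ m b g) ⟩
  C - b * Σℚ m g                      ∎
  where
  open ≡-Reasoning
  C = Σℚ m (λ i → ⌈ b * g i ⌉ℚ)

Σℚ-suc : ∀ m (f : ℕ → ℚ) → Σℚ (suc m) f ≡ f 0 + Σℚ m (λ i → f (suc i))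
Σℚ-suc zero f = ℚP.+-comm 0ℚ (f 0)
Σℚ-suc (suc m) f rewrite Σℚ-suc m f = ℚP.+-assoc (f 0) (Σℚ m (λ i → f (suc i))) (f (suc m))

Σℚ-split : ∀ a b (f : ℕ → ℚ) → Σℚ (a ℕ.+ b) f ≡ Σℚ a f + Σℚ b (λ i → f (a ℕ.+ i))
Σℚ-split a zero f rewrite ℕP.+-identityʳ a = sym (ℚP.+-identityʳ _)
Σℚ-split a (suc b) f rewrite ℕP.+-suc a b | Σℚ-split a b f =
  ℚP.+-assoc (Σℚ a f) (Σℚ b (λ i → f (a ℕ.+ i))) (f (a ℕ.+ b))

Σℚ-ℕℚ : ∀ m (h : ℕ → ℕ) → Σℚ m (λ i → ℕℚ (h i)) ≡ ℕℚ (sum (applyUpTo h m))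
Σℚ-ℕℚ zero h = refl
Σℚ-ℕℚ (suc m) h = begin
  Σℚ (suc m) (λ i → ℕℚ (h i))                  ≡⟨ Σℚ-suc m (λ i → ℕℚ (h i)) ⟩
  ℕℚ (h 0) + Σℚ m (λ i → ℕℚ (h (suc i)))       ≡⟨ cong (_+_ (ℕℚ (h 0))) (Σℚ-ℕℚ m (λ i → h (suc i))) ⟩
  ℕℚ (h 0) + ℕℚ (sum (applyUpTo (λ i → h (suc i)) m)) ≡⟨ fromℤ-+ (+ h 0) (+ _) ⟩
  ℕℚ (sum (applyUpTo h (suc m)))               ∎
  where open ≡-Reasoning

<ᵇ-true : ∀ {m k} → m < k → (m <ᵇ k) ≡ true
<ᵇ-true m<k = Equivalence.to T-≡ (ℕP.<⇒<ᵇ m<k)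

<ᵇ-false : ∀ {m k} → k ≤ m → (m <ᵇ k) ≡ false
<ᵇ-false {m} {k} k≤m with m <ᵇ k in eq
... | false = refl
... | true = ⊥-elim (ℕP.≤⇒≯ k≤m (ℕP.<ᵇ⇒< m k (subst T (sym eq) _)))

≡ᵇ-true : ∀ {m k} → m ≡ k → (m ≡ᵇ k) ≡ true
≡ᵇ-true {m} {k} m≡k = Equivalence.to T-≡ (ℕP.≡⇒≡ᵇ m k m≡k)

≡ᵇ-false : ∀ {m k} → m ≢ k → (m ≡ᵇ k) ≡ false
≡ᵇ-false {m} {k} m≢k with m ≡ᵇ k in eq
... | false = refl
... | true = ⊥-elim (m≢k (ℕP.≡ᵇ⇒≡ m k (subst T (sym eq) _)))

δ : ℕ → ℕ → ℚ
δ t i = if t ≡ᵇ i then 1ℚ else 0ℚ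

δ-≢ : ∀ {t i} → t ≢ i → δ t i ≡ 0ℚ
δ-≢ t≢i rewrite ≡ᵇ-false t≢i = refl

δ-refl : ∀ t → δ t t ≡ 1ℚ
δ-refl t rewrite ≡ᵇ-true {t} refl = refl

δ-shift : ∀ c t i → δ (c ℕ.+ t) (c ℕ.+ i) ≡ δ t i
δ-shift zero t i = refl
δ-shift (suc c) t i = δ-shift c t i

Σℚ-δ-beyond : ∀ m t (c : ℕ → ℚ) → m ≤ t → Σℚ m (λ i → c i * δ t i) ≡ 0ℚ
Σℚ-δ-beyond zero t c m≤t = refl
Σℚ-δ-beyond (suc m) t c m<t
  rewrite Σℚ-δ-beyond m t c (ℕP.<⇒≤ m<t) | δ-≢ (ℕP.>⇒≢ m<t) | ℚP.*-zeroʳ (c m) = refl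

Σℚ-δ : ∀ m t (c : ℕ → ℚ) → t < m → Σℚ m (λ i → c i * δ t i) ≡ c t
Σℚ-δ (suc m) t c t<1+m with ℕP.m≤n⇒m<n∨m≡n (ℕP.≤-pred t<1+m)
... | inj₁ t<m rewrite Σℚ-δ m t c t<m | δ-≢ (ℕP.<⇒≢ t<m) | ℚP.*-zeroʳ (c m) = ℚP.+-identityʳ (c t)
... | inj₂ refl rewrite Σℚ-δ-beyond t t c ℕP.≤-refl | δ-refl t | ℚP.*-identityʳ (c t) = ℚP.+-identityˡ (c t)

isInt-+ : ∀ {x y} → IsInt x → IsInt y → IsInt (x + y)
isInt-+ (a , refl) (b , refl) = a ℤ.+ b , fromℤ-+ a b

isInt-neg : ∀ {x} → IsInt x → IsInt (- x)
isInt-neg (a , refl) = ℤ.- a , fromℤ-neg a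

isInt-Σℚ : ∀ m (f : ℕ → ℚ) → (∀ i → i < m → IsInt (f i)) → IsInt (Σℚ m f)
isInt-Σℚ zero f h = + 0 , refl
isInt-Σℚ (suc m) f h = isInt-+ (isInt-Σℚ m f (λ i i<m → h i (ℕP.m<n⇒m<1+n i<m))) (h m ℕP.≤-refl)

ΣFin-nonPos : ∀ m (f : Fin m → ℚ) → (∀ k → f k ℚ.≤ 0ℚ) → ΣFin m f ℚ.≤ 0ℚ
ΣFin-nonPos zero f h = ℚP.≤-refl
ΣFin-nonPos (suc m) f h = ℚP.+-mono-≤ (h Fin.zero) (ΣFin-nonPos m (λ k → f (Fin.suc k)) (λ k → h (Fin.suc k)))

ΣFin-neg : ∀ m (f : Fin m → ℚ) (k₀ : Fin m) → (∀ k → f k ℚ.≤ 0ℚ) → f k₀ ℚ.< 0ℚ → ΣFin m f ℚ.< 0ℚ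
ΣFin-neg (suc m) f Fin.zero h h₀ =
  ℚP.+-mono-<-≤ h₀ (ΣFin-nonPos m (λ k → f (Fin.suc k)) (λ k → h (Fin.suc k)))
ΣFin-neg (suc m) f (Fin.suc k₀) h h₀ =
  ℚP.+-mono-≤-< (h Fin.zero) (ΣFin-neg m (λ k → f (Fin.suc k)) k₀ (λ k → h (Fin.suc k)) h₀)

*ℕℚ-mono-< : ∀ m {x y} → 0 < m → x ℚ.< y → x * ℕℚ m ℚ.< y * ℕℚ m
*ℕℚ-mono-< (suc m) _ = ℚP.*-monoˡ-<-pos (ℕℚ (suc m))

*ℕℚ-mono-≤ : ∀ m {x y} → x ℚ.≤ y → x * ℕℚ m ℚ.≤ y * ℕℚ m
*ℕℚ-mono-≤ m = ℚP.*-monoʳ-≤-nonNeg (ℕℚ m)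

*ℕℚ-cancel-< : ∀ m {x y} → x * ℕℚ m ℚ.< y * ℕℚ m → x ℚ.< y
*ℕℚ-cancel-< m = ℚP.*-cancelʳ-<-nonNeg (ℕℚ m)

divℚ-*-cancel : ∀ a {Q} → 0 < Q → divℚ a Q * ℕℚ Q ≡ ℕℚ a
divℚ-*-cancel a {suc d} _ = ℚP.toℚᵘ-injective (ℚᵘP.≃-trans (ℚP.toℚᵘ-homo-* (divℚ a (suc d)) (ℕℚ (suc d)))
  (ℚᵘP.≃-trans (ℚᵘP.*-congʳ (ℚP.toℚᵘ-fromℚᵘ (ℚᵘ.mkℚᵘ (+ a) d)))
    (ℚᵘ.*≡* (identity (+ a) (+ suc d)))))
  where
  identity : ∀ a D → (a ℤ.* D) ℤ.* + 1 ≡ a ℤ.* (D ℤ.* + 1)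
  identity = ℤ-solve-∀

divℚ-bounds : ∀ {Q} i → i < Q → 0ℚ ℚ.< divℚ (suc i) Q × divℚ (suc i) Q ℚ.≤ 1ℚ
divℚ-bounds {suc d} i i<Q =
  *ℕℚ-cancel-< (suc d)
    (subst₂ ℚ._<_ (sym (ℚP.*-zeroˡ (ℕℚ (suc d)))) (sym cancel) (fromℤ-mono-< (ℤ.+<+ (s≤s z≤n)))) ,
  ℚP.*-cancelʳ-≤-pos (ℕℚ (suc d))
    (subst₂ ℚ._≤_ (sym cancel) (sym (ℚP.*-identityˡ (ℕℚ (suc d)))) (fromℤ-mono-≤ (ℤ.+≤+ i<Q)))
  where
  cancel : divℚ (suc i) (suc d) * ℕℚ (suc d) ≡ ℕℚ (suc i)
  cancel = divℚ-*-cancel (suc i) (s≤s z≤n)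

module SortedEnumeration {L : ℕ} {xs : List ℚ} (bs : ℕ → ℚ)
  (bs-step : ∀ i → 1 ≤ i → i ≤ L → bs (i ∸ 1) ℚ.≤ bs i)
  (enumerates : applyUpTo (λ i → bs (suc i)) L ↭ xs) where

  bs-mono : ∀ {i j} → i ≤ j → j ≤ L → bs i ℚ.≤ bs j
  bs-mono {i} {zero} i≤0 _ rewrite ℕP.n≤0⇒n≡0 i≤0 = ℚP.≤-refl
  bs-mono {i} {suc j} i≤1+j 1+j≤L with ℕP.m≤n⇒m<n∨m≡n i≤1+j
  ... | inj₁ i<1+j = ℚP.≤-trans (bs-mono (ℕP.≤-pred i<1+j) (ℕP.<⇒≤ 1+j≤L)) (bs-step (suc j) (s≤s z≤n) 1+j≤L)
  ... | inj₂ refl = ℚP.≤-refl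

  bs∈ : ∀ {i} → 1 ≤ i → i ≤ L → bs i ∈ xs
  bs∈ {suc i} _ 1+i≤L = ∈-resp-↭ enumerates (∈-applyUpTo⁺ (λ i → bs (suc i)) 1+i≤L)

  nothing-between : ∀ {i x} → 1 ≤ i → i ≤ L → x ∈ xs → bs (i ∸ 1) ℚ.< x → x ℚ.< bs i → ⊥
  nothing-between {suc i} _ 1+i≤L x∈xs bᵢ<x x<bᵢ₊₁
    with ∈-applyUpTo⁻ (λ i → bs (suc i)) (∈-resp-↭ (↭-sym enumerates) x∈xs)
  ... | t , t<L , refl with ℕP.≤-<-connex (suc t) i
  ...   | inj₁ 1+t≤i = ℚP.<-irrefl refl (ℚP.<-≤-trans bᵢ<x (bs-mono 1+t≤i (ℕP.<⇒≤ 1+i≤L)))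
  ...   | inj₂ i<1+t = ℚP.<-irrefl refl (ℚP.<-≤-trans x<bᵢ₊₁ (bs-mono i<1+t t<L))

module Configuration (r′ s′ : ℕ) (p q : ℕ → ℕ) where
  open Setup (suc r′) (suc s′) p q

  P Q : ℕ → ℚ
  P i = ℕℚ (p (suc i))
  Q j = ℕℚ (q (suc j))

  n≡ : n ≡ suc (r′ ℕ.+ s′)
  n≡ = ℕP.+-suc r′ s′

  p-index<n : ∀ {t} → t < r′ → suc t < n
  p-index<n {t} t<r′ = subst (suc (suc t) ≤_) (sym n≡) (s≤s (ℕP.≤-trans t<r′ (ℕP.m≤m+n r′ s′)))

  q-index<n : ∀ {j} → j < s′ → suc (r′ ℕ.+ j) < n
  q-index<n {j} j<s′ = subst (suc (suc (r′ ℕ.+ j)) ≤_) (sym n≡) (s≤s (ℕP.+-monoʳ-< r′ j<s′))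

  r′+1+j<n : ∀ {j} → j < s′ → r′ ℕ.+ suc j < n
  r′+1+j<n j<s′ = ℕP.+-monoʳ-< r′ (s≤s j<s′)

  -- Coordinate 0, the coordinates 1..r-1 (where e n has entry p) and r..n-1 (entry -q).
  data Coordinate : ℕ → Set where
    origin       : Coordinate 0
    p-coordinate : ∀ {t} → t < r′ → Coordinate (suc t)
    q-coordinate : ∀ {j} → j < s′ → Coordinate (suc (r′ ℕ.+ j))

  coordinate : ∀ {t} → t < n → Coordinate t
  coordinate {zero} _ = origin
  coordinate {suc t} 1+t<n with t ℕ.<? r′
  ... | yes t<r′ = p-coordinate t<r′
  ... | no t≮r′ = subst Coordinate (cong suc r′+[t∸r′]≡t)
                    (q-coordinate (ℕP.+-cancelˡ-< r′ _ _ (subst (_< r′ ℕ.+ s′) (sym r′+[t∸r′]≡t) t<r′+s′)))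
    where
    r′+[t∸r′]≡t : r′ ℕ.+ (t ∸ r′) ≡ t
    r′+[t∸r′]≡t = ℕP.m+[n∸m]≡n (ℕP.≮⇒≥ t≮r′)
    t<r′+s′ : t < r′ ℕ.+ s′
    t<r′+s′ = ℕP.≤-pred (subst (suc t <_) n≡ 1+t<n)

  eₙ : ℕ → ℚ
  eₙ t = if t ≡ᵇ 0 then 1ℚ else (if t <ᵇ suc r′ then ℕℚ (p t) else - ℕℚ (q (suc (t ∸ suc r′))))

  E : ℕ → ℕ → ℚ
  E zero t = if t ≡ᵇ 0 then 1ℚ else 0ℚ
  E (suc i) t with suc i ≡ᵇ n
  ... | false = if t ≡ᵇ 0 then 1ℚ else δ t (suc i)
  ... | true  = eₙ t

  e≡E : ∀ i k → e i k ≡ E i (toℕ k)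
  e≡E zero k = refl
  e≡E (suc i) k with suc i ≡ᵇ n
  ... | false = refl
  ... | true = refl

  E-0 : ∀ {i} → i < n → E i 0 ≡ 1ℚ
  E-0 {zero} _ = refl
  E-0 {suc i} i<n rewrite ≡ᵇ-false (ℕP.<⇒≢ i<n) = refl

  E-suc : ∀ {i} → i < n → ∀ t → E i (suc t) ≡ δ (suc t) i
  E-suc {zero} _ t = refl
  E-suc {suc i} i<n t rewrite ≡ᵇ-false (ℕP.<⇒≢ i<n) = refl

  E-n : ∀ t → E n t ≡ eₙ t
  E-n t = subst (λ i → E i t ≡ eₙ t) (sym n≡) top
    where
    top : E (suc (r′ ℕ.+ s′)) t ≡ eₙ t
    top rewrite ≡ᵇ-true (sym n≡) = refl

  eₙ-p : ∀ {t} → t < r′ → eₙ (suc t) ≡ P t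
  eₙ-p t<r′ rewrite <ᵇ-true t<r′ = refl

  eₙ-q : ∀ j → eₙ (suc (r′ ℕ.+ j)) ≡ - Q j
  eₙ-q j rewrite <ᵇ-false (ℕP.m≤m+n r′ j) | ℕP.m+n∸m≡n r′ j = refl

  Σℚ-by-block : ∀ (f : ℕ → ℚ) →
    Σℚ n f ≡ f 0 + (Σℚ r′ (λ i → f (suc i)) + Σℚ s′ (λ j → f (suc (r′ ℕ.+ j))))
  Σℚ-by-block f = trans (cong (λ m → Σℚ m f) n≡)
    (trans (Σℚ-suc (r′ ℕ.+ s′) f) (cong (_+_ (f 0)) (Σℚ-split r′ s′ (λ i → f (suc i)))))

  span-coord-0 : ∀ (c : ℕ → ℚ) → Σℚ n (λ i → c i * E i 0) ≡ Σℚ n c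
  span-coord-0 c = Σℚ-cong n (λ i i<n → trans (cong (c i *_) (E-0 i<n)) (ℚP.*-identityʳ (c i)))

  span-coord-suc : ∀ (c : ℕ → ℚ) {t} → suc t < n → Σℚ n (λ i → c i * E i (suc t)) ≡ c (suc t)
  span-coord-suc c {t} 1+t<n =
    trans (Σℚ-cong n (λ i i<n → cong (c i *_) (E-suc i<n t))) (Σℚ-δ n (suc t) c 1+t<n)

  cone-coord-0 : ∀ (c : ℕ → ℚ) → Σℚ (suc n) (λ i → c i * E i 0) ≡ Σℚ n c + c n
  cone-coord-0 c = cong₂ _+_ (span-coord-0 c) (trans (cong (c n *_) (E-n 0)) (ℚP.*-identityʳ (c n)))

  cone-coord-p : ∀ (c : ℕ → ℚ) {t} → t < r′ → Σℚ (suc n) (λ i → c i * E i (suc t)) ≡ c (suc t) + c n * P t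
  cone-coord-p c t<r′ =
    cong₂ _+_ (span-coord-suc c (p-index<n t<r′)) (cong (c n *_) (trans (E-n _) (eₙ-p t<r′)))

  cone-coord-q : ∀ (c : ℕ → ℚ) {j} → j < s′ →
    Σℚ (suc n) (λ i → c i * E i (suc (r′ ℕ.+ j))) ≡ c (suc (r′ ℕ.+ j)) + c n * (- Q j)
  cone-coord-q c {j} j<s′ =
    cong₂ _+_ (span-coord-suc c (q-index<n j<s′)) (cong (c n *_) (trans (E-n _) (eₙ-q j)))

  coeff : ℚ → ℕ → ℚ
  coeff b zero = frac (- (b * P r′))
  coeff b (suc i) = if suc i ≡ᵇ n then b else (if i <ᵇ r′ then frac (- (b * P i)) else frac (b * Q (i ∸ r′)))

  coeff-p : ∀ b {t} → t < r′ → coeff b (suc t) ≡ frac (- (b * P t))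
  coeff-p b t<r′ rewrite ≡ᵇ-false (ℕP.<⇒≢ (p-index<n t<r′)) | <ᵇ-true t<r′ = refl

  coeff-q : ∀ b {j} → j < s′ → coeff b (suc (r′ ℕ.+ j)) ≡ frac (b * Q j)
  coeff-q b {j} j<s′
    rewrite ≡ᵇ-false (ℕP.<⇒≢ (q-index<n j<s′)) | <ᵇ-false (ℕP.m≤m+n r′ j) | ℕP.m+n∸m≡n r′ j = refl

  coeff-n : ∀ b → coeff b n ≡ b
  coeff-n b = subst (λ i → coeff b i ≡ b) (sym n≡) top
    where
    top : coeff b (suc (r′ ℕ.+ s′)) ≡ b
    top rewrite ≡ᵇ-true (sym n≡) = refl

  coeff-nonNeg : ∀ {b} → 0ℚ ℚ.≤ b → ∀ i → 0ℚ ℚ.≤ coeff b i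
  coeff-nonNeg {b} 0≤b zero = frac-nonNeg (- (b * P r′))
  coeff-nonNeg {b} 0≤b (suc i) with suc i ≡ᵇ n | i <ᵇ r′
  ... | true  | _     = 0≤b
  ... | false | true  = frac-nonNeg (- (b * P i))
  ... | false | false = frac-nonNeg (b * Q (i ∸ r′))

  coeff-Σ : ∀ b → Σℚ n (coeff b) ≡ Σℚ (suc r′) (λ i → frac (- (b * P i))) + Σℚ s′ (λ j → frac (b * Q j))
  coeff-Σ b = trans (Σℚ-by-block (coeff b))
    (trans (cong (_+_ (coeff b 0))
                 (cong₂ _+_ (Σℚ-cong r′ (λ i → coeff-p b)) (Σℚ-cong s′ (λ j → coeff-q b))))
           (identity (coeff b 0) (Σℚ r′ (λ i → frac (- (b * P i)))) (Σℚ s′ (λ j → frac (b * Q j)))))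
    where
    identity : ∀ x y z → x + (y + z) ≡ (y + x) + z
    identity = solve-∀ ℚ-ring

  coord : ℚ → ℕ → ℚ
  coord b t = Σℚ (suc n) (λ i → coeff b i * E i t)

  u-coord : ∀ b k → u b k ≡ coord b (toℕ k)
  u-coord b k = begin
    u b k                                ≡⟨ cong₂ _+_ (cong₂ _*_ (sym (coeff-n b)) (e≡E n k)) lower-terms ⟩
    coeff b n * E n t + Σℚ n lower       ≡⟨ ℚP.+-comm (coeff b n * E n t) (Σℚ n lower) ⟩
    coord b t                            ∎
    where
    open ≡-Reasoning
    t : ℕ
    t = toℕ k
    lower : ℕ → ℚ
    lower i = coeff b i * E i t
    p-terms : Σℚ r′ (λ i → frac (- (b * P i)) * e (suc i) k) ≡ Σℚ r′ (λ i → lower (suc i))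
    p-terms = Σℚ-cong r′ λ i i<r′ → cong₂ _*_ (sym (coeff-p b i<r′)) (e≡E (suc i) k)
    q-terms : Σℚ s′ (λ j → frac (b * Q j) * e (r′ ℕ.+ suc j) k) ≡ Σℚ s′ (λ j → lower (suc (r′ ℕ.+ j)))
    q-terms = Σℚ-cong s′ λ j j<s′ → cong₂ _*_ (sym (coeff-q b j<s′))
                (trans (e≡E (r′ ℕ.+ suc j) k) (cong (λ i → E i t) (ℕP.+-suc r′ j)))
    lower-terms : frac (- (b * P r′)) * e 0 k
                    + (Σℚ r′ (λ i → frac (- (b * P i)) * e (suc i) k)
                      + Σℚ s′ (λ j → frac (b * Q j) * e (r′ ℕ.+ suc j) k))
                  ≡ Σℚ n lower
    lower-terms = trans (cong₂ _+_ (cong (coeff b 0 *_) (e≡E 0 k)) (cong₂ _+_ p-terms q-terms))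
                        (sym (Σℚ-by-block lower))

  u-fromℕ< : ∀ b {t} (t<n : t < n) → u b (fromℕ< t<n) ≡ coord b t
  u-fromℕ< b t<n = trans (u-coord b _) (cong (coord b) (FinP.toℕ-fromℕ< t<n))

  coord-p : ∀ b {t} → t < r′ → coord b (suc t) ≡ ⌈ b * P t ⌉ℚ
  coord-p b {t} t<r′ = begin
    coord b (suc t)                   ≡⟨ cone-coord-p (coeff b) t<r′ ⟩
    coeff b (suc t) + coeff b n * P t ≡⟨ cong₂ (λ x y → x + y * P t) (coeff-p b t<r′) (coeff-n b) ⟩
    frac (- (b * P t)) + b * P t      ≡⟨ cong (_+ b * P t) (frac-neg (b * P t)) ⟩
    ⌈ b * P t ⌉ℚ - b * P t + b * P t  ≡⟨ identity ⌈ b * P t ⌉ℚ (b * P t) ⟩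
    ⌈ b * P t ⌉ℚ                      ∎
    where
    open ≡-Reasoning
    identity : ∀ x y → x - y + y ≡ x
    identity = solve-∀ ℚ-ring

  coord-q : ∀ b {j} → j < s′ → coord b (suc (r′ ℕ.+ j)) ≡ - ⌊ b * Q j ⌋ℚ
  coord-q b {j} j<s′ = begin
    coord b (suc (r′ ℕ.+ j))                    ≡⟨ cone-coord-q (coeff b) j<s′ ⟩
    coeff b (suc (r′ ℕ.+ j)) + coeff b n * (- Q j) ≡⟨ cong₂ (λ x y → x + y * (- Q j)) (coeff-q b j<s′) (coeff-n b) ⟩
    b * Q j - ⌊ b * Q j ⌋ℚ + b * (- Q j)        ≡⟨ identity b (Q j) ⌊ b * Q j ⌋ℚ ⟩
    - ⌊ b * Q j ⌋ℚ                              ∎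
    where
    open ≡-Reasoning
    identity : ∀ b y z → b * y - z + b * (- y) ≡ - z
    identity = solve-∀ ℚ-ring

  Balance : Set
  Balance = Σℚ (suc r′) P ≡ Σℚ s′ Q + 1ℚ

  balance : ∀ {L} → q (suc s′) ≡ 1 →
    sum (applyUpTo (λ i → p (suc i)) (suc r′)) ≡ L → sum (applyUpTo (λ j → q (suc j)) (suc s′)) ≡ L → Balance
  balance q-last Σp≡L Σq≡L = begin
    Σℚ (suc r′) P                                  ≡⟨ Σℚ-ℕℚ (suc r′) (λ i → p (suc i)) ⟩
    ℕℚ (sum (applyUpTo (λ i → p (suc i)) (suc r′))) ≡⟨ cong ℕℚ (trans Σp≡L (sym Σq≡L)) ⟩
    ℕℚ (sum (applyUpTo (λ j → q (suc j)) (suc s′))) ≡⟨ sym (Σℚ-ℕℚ (suc s′) (λ j → q (suc j))) ⟩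
    Σℚ s′ Q + ℕℚ (q (suc s′))                      ≡⟨ cong (λ m → Σℚ s′ Q + ℕℚ m) q-last ⟩
    Σℚ s′ Q + 1ℚ                                   ∎
    where open ≡-Reasoning

  -- The weights b cancel from coordinate 0 exactly because Σ p = Σ q and q s = 1.
  coord-0 : Balance → ∀ b → coord b 0 ≡ Σℚ (suc r′) (λ i → ⌈ b * P i ⌉ℚ) - Σℚ s′ (λ j → ⌊ b * Q j ⌋ℚ)
  coord-0 bal b = begin
    coord b 0
      ≡⟨ cone-coord-0 (coeff b) ⟩
    Σℚ n (coeff b) + coeff b n
      ≡⟨ cong₂ _+_ (coeff-Σ b) (coeff-n b) ⟩
    Σℚ (suc r′) (λ i → frac (- (b * P i))) + Σℚ s′ (λ j → frac (b * Q j)) + b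
      ≡⟨ cong₂ (λ x y → x + y + b) (Σℚ-frac-neg (suc r′) b P) (Σℚ-frac s′ b Q) ⟩
    (C - b * Σℚ (suc r′) P) + (b * Σℚ s′ Q - F) + b
      ≡⟨ cong (λ z → (C - b * z) + (b * Σℚ s′ Q - F) + b) bal ⟩
    (C - b * (Σℚ s′ Q + 1ℚ)) + (b * Σℚ s′ Q - F) + b
      ≡⟨ identity C F b (Σℚ s′ Q) ⟩
    C - F ∎
    where
    open ≡-Reasoning
    C = Σℚ (suc r′) (λ i → ⌈ b * P i ⌉ℚ)
    F = Σℚ s′ (λ j → ⌊ b * Q j ⌋ℚ)
    identity : ∀ C F b y → (C - b * (y + 1ℚ)) + (b * y - F) + b ≡ C - F
    identity = solve-∀ ℚ-ring

  coord-integral : Balance → ∀ b {t} → Coordinate t → IsInt (coord b t)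
  coord-integral bal b origin = subst IsInt (sym (coord-0 bal b))
    (isInt-+ (isInt-Σℚ (suc r′) _ (λ i _ → ceiling (b * P i) , refl))
             (isInt-neg (isInt-Σℚ s′ _ (λ j _ → floor (b * Q j) , refl))))
  coord-integral bal b (p-coordinate t<r′) = subst IsInt (sym (coord-p b t<r′)) (ceiling (b * P _) , refl)
  coord-integral bal b (q-coordinate j<s′) = subst IsInt (sym (coord-q b j<s′)) (isInt-neg (floor (b * Q _) , refl))

  u∈G : Balance → ∀ {b} → 0ℚ ℚ.≤ b → InG (u b)
  u∈G bal {b} 0≤b =
    (coeff b , (λ i _ → coeff-nonNeg 0≤b i) ,
     λ k → trans (u-coord b k) (sym (Σℚ-cong (suc n) λ i _ → cong (coeff b i *_) (e≡E i k)))) ,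
    λ k → subst IsInt (sym (u-coord b k)) (coord-integral bal b (coordinate (FinP.toℕ<n k)))

  ∈β⇒ : ∀ {b} → b ∈ βlist → ∃[ j ] ∃[ i ] j < suc s′ × i < q (suc j) × b ≡ divℚ (suc i) (q (suc j))
  ∈β⇒ b∈β with ∈-concat⁻′ _ b∈β
  ... | xs , b∈xs , xs∈ with ∈-applyUpTo⁻ (λ j → applyUpTo (λ i → divℚ (suc i) (q (suc j))) (q (suc j))) xs∈
  ...   | j , j<s , refl with ∈-applyUpTo⁻ (λ i → divℚ (suc i) (q (suc j))) b∈xs
  ...     | i , i<q , refl = j , i , j<s , i<q , refl

  divℚ∈β : ∀ {j i} → j < suc s′ → i < q (suc j) → divℚ (suc i) (q (suc j)) ∈ βlist
  divℚ∈β {j} j<s i<q = ∈-concat⁺′ (∈-applyUpTo⁺ (λ i → divℚ (suc i) (q (suc j))) i<q)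
    (∈-applyUpTo⁺ (λ j → applyUpTo (λ i → divℚ (suc i) (q (suc j))) (q (suc j))) j<s)

  β-bounds : ∀ {b} → b ∈ βlist → 0ℚ ℚ.< b × b ℚ.≤ 1ℚ
  β-bounds b∈β with ∈β⇒ b∈β
  ... | j , i , _ , i<q , refl = divℚ-bounds i i<q

  coord-q-of-integer : ∀ b {j z} → j < s′ → b * Q j ≡ fromℤ z → coord b (suc (r′ ℕ.+ j)) ≡ - fromℤ z
  coord-q-of-integer b j<s′ bQ≡z = trans (coord-q b j<s′) (cong (λ x → - fromℤ x) (trans (cong floor bQ≡z) (floor-fromℤ _)))

  module _ (q>0 : ∀ j → 1 ≤ j → j ≤ suc s′ → 0 < q j) where

    q-positive : ∀ {j} → j < s′ → 0 < q (suc j)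
    q-positive j<s′ = q>0 _ (s≤s z≤n) (s≤s (ℕP.<⇒≤ j<s′))

    u-primitive : ∀ {b j} → 0ℚ ℚ.< b → j < s′ → IsInt (b * Q j) → Primitive (u b)
    u-primitive {b} {j} 0<b j<s′ (z , bQ≡z) =
      ΣFin-neg n (λ k → u b k ℚ.⊓ 0ℚ) k₀ (λ k → ℚP.p⊓q≤q (u b k) 0ℚ)
        (subst (ℚ._< 0ℚ) (sym (ℚP.p≤q⇒p⊓q≡p (ℚP.<⇒≤ u<0))) u<0)
      where
      k₀ : Fin n
      k₀ = fromℕ< (q-index<n j<s′)
      0<z : 0ℚ ℚ.< fromℤ z
      0<z = subst (0ℚ ℚ.<_) bQ≡z
        (subst (ℚ._< b * Q j) (ℚP.*-zeroˡ (Q j)) (*ℕℚ-mono-< (q (suc j)) (q-positive j<s′) 0<b))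
      u<0 : u b k₀ ℚ.< 0ℚ
      u<0 = subst (ℚ._< 0ℚ) (sym (trans (u-fromℕ< b (q-index<n j<s′)) (coord-q-of-integer b j<s′ bQ≡z)))
              (ℚP.neg-antimono-< 0<z)

    u-separates : ∀ {b′ b j} → b′ ℚ.< b → j < s′ → IsInt (b * Q j) → ¬ (∀ k → u b′ k ≡ u b k)
    u-separates {b′} {b} {j} b′<b j<s′ (z , bQ≡z) u≡ = ℚP.<-irrefl ⌊b′Q⌋≡z (fromℤ-mono-< ⌊b′Q⌋<z)
      where
      k₀ : Fin n
      k₀ = fromℕ< (q-index<n j<s′)
      ⌊b′Q⌋<z : floor (b′ * Q j) ℤ.< z
      ⌊b′Q⌋<z = floor-< (subst (b′ * Q j ℚ.<_) bQ≡z (*ℕℚ-mono-< (q (suc j)) (q-positive j<s′) b′<b))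
      ⌊b′Q⌋≡z : ⌊ b′ * Q j ⌋ℚ ≡ fromℤ z
      ⌊b′Q⌋≡z = ℚP.neg-injective (begin
        - ⌊ b′ * Q j ⌋ℚ              ≡⟨ sym (coord-q b′ j<s′) ⟩
        coord b′ (suc (r′ ℕ.+ j))   ≡⟨ sym (u-fromℕ< b′ (q-index<n j<s′)) ⟩
        u b′ k₀                     ≡⟨ u≡ k₀ ⟩
        u b k₀                      ≡⟨ u-fromℕ< b (q-index<n j<s′) ⟩
        coord b (suc (r′ ℕ.+ j))    ≡⟨ coord-q-of-integer b j<s′ bQ≡z ⟩
        - fromℤ z                   ∎)
        where open ≡-Reasoning

    module _ (q-last : q (suc s′) ≡ 1) (0<s′ : 0 < s′) where

      -- Every b ∈ β is an integer multiple of 1/q j for some j < s; for b = 1 this needs s ≥ 2.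
      β-witness : ∀ {b} → b ∈ βlist → ∃[ j ] j < s′ × IsInt (b * Q j)
      β-witness b∈β with ∈β⇒ b∈β
      ... | j , i , j<s , i<q , refl with ℕP.m≤n⇒m<n∨m≡n (ℕP.≤-pred j<s)
      ...   | inj₁ j<s′ = j , j<s′ , + suc i , divℚ-*-cancel (suc i) (q-positive j<s′)
      ...   | inj₂ refl rewrite q-last with ℕP.n<1⇒n≡0 i<q
      ...     | refl = 0 , 0<s′ , + q 1 , ℚP.*-identityˡ (Q 0)

      β-primitive : ∀ {b} → b ∈ βlist → Primitive (u b)
      β-primitive b∈β with β-witness b∈β
      ... | j , j<s′ , bQ∈ℤ = u-primitive (proj₁ (β-bounds b∈β)) j<s′ bQ∈ℤ

      β-separated : ∀ {b′ b} → b′ ℚ.< b → b ∈ βlist → ¬ (∀ k → u b′ k ≡ u b k)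
      β-separated b′<b b∈β with β-witness b∈β
      ... | j , j<s′ , bQ∈ℤ = u-separates b′<b j<s′ bQ∈ℤ

      β-distinct : ∀ {b b′} → b ∈ βlist → b′ ∈ βlist → b ≢ b′ → ¬ (∀ k → u b k ≡ u b′ k)
      β-distinct {b} {b′} b∈β b′∈β b≢b′ u≡ with ℚP.<-cmp b b′
      ... | tri< b<b′ _ _ = β-separated b<b′ b′∈β u≡
      ... | tri≈ _ b≡b′ _ = b≢b′ b≡b′
      ... | tri> _ _ b>b′ = β-separated b>b′ b∈β (λ k → sym (u≡ k))

    module Consecutive (bal : Balance) {b′ b : ℚ} (0≤b′ : 0ℚ ℚ.≤ b′) (b′<b : b′ ℚ.< b) (b≤1 : b ℚ.≤ 1ℚ)
                (gap : ∀ x → x ∈ βlist → b′ ℚ.< x → x ℚ.< b → ⊥) where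

      b′Q<bQ : ∀ {j} → j < s′ → b′ * Q j ℚ.< b * Q j
      b′Q<bQ {j} j<s′ = *ℕℚ-mono-< (q (suc j)) (q-positive j<s′) b′<b

      0≤b′Q : ∀ j → 0ℚ ℚ.≤ b′ * Q j
      0≤b′Q j = subst (ℚ._≤ b′ * Q j) (ℚP.*-zeroˡ (Q j)) (*ℕℚ-mono-≤ (q (suc j)) 0≤b′)

      -- An integer m in (b′ q j, b q j) is positive, so m / q j ∈ β would lie strictly between b′ and b.
      no-integer-between : ∀ {j} → j < s′ → ∀ m → b′ * Q j ℚ.< fromℤ m → fromℤ m ℚ.< b * Q j → ⊥
      no-integer-between {j} j<s′ m b′Q<m m<bQ with fromℤ-cancel-< {+ 0} {m} (ℚP.≤-<-trans (0≤b′Q j) b′Q<m)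
      ... | ℤ.+<+ {n = suc t} _ = gap (divℚ (suc t) (q (suc j))) (divℚ∈β (ℕP.m<n⇒m<1+n j<s′) t<q)
          (*ℕℚ-cancel-< (q (suc j)) (subst (b′ * Q j ℚ.<_) (sym cancel) b′Q<m))
          (*ℕℚ-cancel-< (q (suc j)) (subst (ℚ._< b * Q j) (sym cancel) m<bQ))
        where
        cancel : divℚ (suc t) (q (suc j)) * Q j ≡ fromℤ (+ suc t)
        cancel = divℚ-*-cancel (suc t) (q-positive j<s′)
        t<q : t < q (suc j)
        t<q = ℕP.<⇒≤ (ℤP.drop‿+<+ (fromℤ-cancel-< (ℚP.<-≤-trans m<bQ
                (subst (b * Q j ℚ.≤_) (ℚP.*-identityˡ (Q j)) (*ℕℚ-mono-≤ (q (suc j)) b≤1)))))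

      ind : ℕ → ℚ
      ind j = if does (isInt? (b * Q j)) then 1ℚ else 0ℚ

      floor-step : ∀ {j} → j < s′ → ⌊ b * Q j ⌋ℚ ≡ ⌊ b′ * Q j ⌋ℚ + ind j
      floor-step {j} j<s′ with isInt? (b * Q j)
      ... | yes (z , bQ≡z) = begin
        ⌊ b * Q j ⌋ℚ               ≡⟨ cong (λ x → fromℤ (floor x)) bQ≡z ⟩
        fromℤ (floor (fromℤ z))    ≡⟨ cong fromℤ (floor-fromℤ z) ⟩
        fromℤ z                    ≡⟨ cong fromℤ (sym (ℤP.suc-pred z)) ⟩
        fromℤ (ℤ.suc (ℤ.pred z))   ≡⟨ fromℤ-suc (ℤ.pred z) ⟩
        fromℤ (ℤ.pred z) + 1ℚ      ≡⟨ cong (λ x → fromℤ x + 1ℚ) (sym ⌊b′Q⌋≡z-1) ⟩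
        ⌊ b′ * Q j ⌋ℚ + 1ℚ         ∎
        where
        open ≡-Reasoning
        ⌊b′Q⌋≡z-1 : floor (b′ * Q j) ≡ ℤ.pred z
        ⌊b′Q⌋≡z-1 = floor-of-gap (ℤ.pred z) (b′Q<bQ j<s′)
          (subst (fromℤ (ℤ.pred z) ℚ.<_) (sym bQ≡z) (fromℤ-mono-< (ℤP.i≤pred[j]⇒i<j ℤP.≤-refl)))
          (ℚP.≤-reflexive (trans bQ≡z (cong fromℤ (sym (ℤP.suc-pred z)))))
          (no-integer-between j<s′)
      ... | no bQ∉ℤ = trans (cong fromℤ (sym ⌊b′Q⌋≡⌊bQ⌋)) (sym (ℚP.+-identityʳ _))
        where
        ⌊b′Q⌋≡⌊bQ⌋ : floor (b′ * Q j) ≡ floor (b * Q j)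
        ⌊b′Q⌋≡⌊bQ⌋ = floor-of-gap (floor (b * Q j)) (b′Q<bQ j<s′) (floor<-nonInt bQ∉ℤ)
          (ℚP.<⇒≤ (<floor+1 (b * Q j))) (no-integer-between j<s′)

      Δ : ℕ → ℕ
      Δ i = ℤ.∣ ceiling (b * P i) ℤ.- ceiling (b′ * P i) ∣

      Δ-value : ∀ i → ℕℚ (Δ i) ≡ ⌈ b * P i ⌉ℚ - ⌈ b′ * P i ⌉ℚ
      Δ-value i = ℕℚ-∣-∣ (ceiling-mono (*ℕℚ-mono-≤ (p (suc i)) (ℚP.<⇒≤ b′<b)))

      -- The coefficients of the element of H that carries u b′ to u b + sumS b.
      a : ℕ → ℕ
      a zero = Δ r′
      a (suc i) = if i <ᵇ r′ then Δ i else 0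

      a-p : ∀ {t} → t < r′ → a (suc t) ≡ Δ t
      a-p t<r′ rewrite <ᵇ-true t<r′ = refl

      a-q : ∀ j → a (suc (r′ ℕ.+ j)) ≡ 0
      a-q j rewrite <ᵇ-false (ℕP.m≤m+n r′ j) = refl

      span-a-0 : Σℚ n (λ i → ℕℚ (a i) * E i 0)
                 ≡ Σℚ (suc r′) (λ i → ⌈ b * P i ⌉ℚ) - Σℚ (suc r′) (λ i → ⌈ b′ * P i ⌉ℚ)
      span-a-0 = begin
        Σℚ n (λ i → ℕℚ (a i) * E i 0)
          ≡⟨ trans (span-coord-0 (λ i → ℕℚ (a i))) (Σℚ-by-block (λ i → ℕℚ (a i))) ⟩
        ℕℚ (Δ r′) + (Σℚ r′ (λ i → ℕℚ (a (suc i))) + Σℚ s′ (λ j → ℕℚ (a (suc (r′ ℕ.+ j)))))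
          ≡⟨ cong (_+_ (ℕℚ (Δ r′))) (cong₂ _+_ (Σℚ-cong r′ (λ i i<r′ → cong ℕℚ (a-p i<r′)))
                                                (trans (Σℚ-cong s′ (λ j _ → cong ℕℚ (a-q j))) (Σℚ-zero s′))) ⟩
        ℕℚ (Δ r′) + (Σℚ r′ (λ i → ℕℚ (Δ i)) + 0ℚ)
          ≡⟨ trans (cong (_+_ (ℕℚ (Δ r′))) (ℚP.+-identityʳ ΣΔ)) (ℚP.+-comm (ℕℚ (Δ r′)) ΣΔ) ⟩
        Σℚ (suc r′) (λ i → ℕℚ (Δ i))
          ≡⟨ trans (Σℚ-cong (suc r′) (λ i _ → Δ-value i)) (Σℚ-minus (suc r′) _ _) ⟩
        Σℚ (suc r′) (λ i → ⌈ b * P i ⌉ℚ) - Σℚ (suc r′) (λ i → ⌈ b′ * P i ⌉ℚ) ∎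
        where
        open ≡-Reasoning
        ΣΔ = Σℚ r′ (λ i → ℕℚ (Δ i))

      S : ℕ → ℚ
      S t = Σℚ s′ (λ j → ind j * E (r′ ℕ.+ suc j) t)

      sumS-coord : ∀ k → sumS b k ≡ S (toℕ k)
      sumS-coord k = Σℚ-cong s′ λ j _ → term j
        where
        term : ∀ j → (if does (isInt? (b * Q j)) then e (r′ ℕ.+ suc j) else 0ᵥ) k
                     ≡ ind j * E (r′ ℕ.+ suc j) (toℕ k)
        term j with does (isInt? (b * Q j))
        ... | true = trans (e≡E (r′ ℕ.+ suc j) k) (sym (ℚP.*-identityˡ _))
        ... | false = sym (ℚP.*-zeroˡ (E (r′ ℕ.+ suc j) (toℕ k)))

      S-0 : S 0 ≡ Σℚ s′ ind
      S-0 = Σℚ-cong s′ λ j j<s′ → trans (cong (ind j *_) (E-0 (r′+1+j<n j<s′))) (ℚP.*-identityʳ (ind j))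

      S-p : ∀ {t} → t < r′ → S (suc t) ≡ 0ℚ
      S-p {t} t<r′ = trans (Σℚ-cong s′ λ j j<s′ →
          trans (cong (ind j *_) (trans (E-suc (r′+1+j<n j<s′) t) (δ-≢ (ℕP.<⇒≢ (1+t<r′+1+j j)))))
                (ℚP.*-zeroʳ (ind j)))
        (Σℚ-zero s′)
        where
        1+t<r′+1+j : ∀ j → suc t < r′ ℕ.+ suc j
        1+t<r′+1+j j = ℕP.≤-<-trans t<r′ (ℕP.m<m+n r′ (s≤s z≤n))

      S-q : ∀ {j} → j < s′ → S (suc (r′ ℕ.+ j)) ≡ ind j
      S-q {j} j<s′ = trans (Σℚ-cong s′ λ i i<s′ →
          cong (ind i *_) (trans (E-suc (r′+1+j<n i<s′) (r′ ℕ.+ j))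
                                 (trans (cong (δ (suc (r′ ℕ.+ j))) (ℕP.+-suc r′ i)) (δ-shift r′ j i))))
        (Σℚ-δ s′ j ind j<s′)

      step-coord : ∀ {t} → Coordinate t → coord b t + S t ≡ coord b′ t + Σℚ n (λ i → ℕℚ (a i) * E i t)
      step-coord origin = begin
        coord b 0 + S 0
          ≡⟨ cong₂ _+_ (coord-0 bal b) S-0 ⟩
        C - F + Σℚ s′ ind
          ≡⟨ cong (λ x → C - x + Σℚ s′ ind) (trans (Σℚ-cong s′ λ j → floor-step) (Σℚ-+ s′ _ ind)) ⟩
        C - (F′ + Σℚ s′ ind) + Σℚ s′ ind
          ≡⟨ identity C C′ F′ (Σℚ s′ ind) ⟩
        C′ - F′ + (C - C′)
          ≡⟨ sym (cong₂ _+_ (coord-0 bal b′) span-a-0) ⟩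
        coord b′ 0 + Σℚ n (λ i → ℕℚ (a i) * E i 0) ∎
        where
        open ≡-Reasoning
        C = Σℚ (suc r′) (λ i → ⌈ b * P i ⌉ℚ)
        C′ = Σℚ (suc r′) (λ i → ⌈ b′ * P i ⌉ℚ)
        F = Σℚ s′ (λ j → ⌊ b * Q j ⌋ℚ)
        F′ = Σℚ s′ (λ j → ⌊ b′ * Q j ⌋ℚ)
        identity : ∀ C C′ F′ I → C - (F′ + I) + I ≡ C′ - F′ + (C - C′)
        identity = solve-∀ ℚ-ring
      step-coord (p-coordinate {t} t<r′) = begin
        coord b (suc t) + S (suc t)
          ≡⟨ cong₂ _+_ (coord-p b t<r′) (S-p t<r′) ⟩
        ⌈ b * P t ⌉ℚ + 0ℚ
          ≡⟨ identity ⌈ b * P t ⌉ℚ ⌈ b′ * P t ⌉ℚ ⟩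
        ⌈ b′ * P t ⌉ℚ + (⌈ b * P t ⌉ℚ - ⌈ b′ * P t ⌉ℚ)
          ≡⟨ sym (cong₂ _+_ (coord-p b′ t<r′)
                   (trans (span-coord-suc (λ i → ℕℚ (a i)) (p-index<n t<r′)) (trans (cong ℕℚ (a-p t<r′)) (Δ-value t)))) ⟩
        coord b′ (suc t) + Σℚ n (λ i → ℕℚ (a i) * E i (suc t)) ∎
        where
        open ≡-Reasoning
        identity : ∀ x y → x + 0ℚ ≡ y + (x - y)
        identity = solve-∀ ℚ-ring
      step-coord (q-coordinate {j} j<s′) = begin
        coord b (suc (r′ ℕ.+ j)) + S (suc (r′ ℕ.+ j))
          ≡⟨ cong₂ _+_ (coord-q b j<s′) (S-q j<s′) ⟩
        - ⌊ b * Q j ⌋ℚ + ind j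
          ≡⟨ cong (λ x → - x + ind j) (floor-step j<s′) ⟩
        - (⌊ b′ * Q j ⌋ℚ + ind j) + ind j
          ≡⟨ identity ⌊ b′ * Q j ⌋ℚ (ind j) ⟩
        - ⌊ b′ * Q j ⌋ℚ + 0ℚ
          ≡⟨ sym (cong₂ _+_ (coord-q b′ j<s′)
                   (trans (span-coord-suc (λ i → ℕℚ (a i)) (q-index<n j<s′)) (cong ℕℚ (a-q j)))) ⟩
        coord b′ (suc (r′ ℕ.+ j)) + Σℚ n (λ i → ℕℚ (a i) * E i (suc (r′ ℕ.+ j))) ∎
        where
        open ≡-Reasoning
        identity : ∀ x y → - (x + y) + y ≡ - x + 0ℚ
        identity = solve-∀ ℚ-ring

      u+sumS∈u′+H : InTranslateH (u b +ᵥ sumS b) (u b′)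
      u+sumS∈u′+H = a , λ k → begin
        u b k + sumS b k                                   ≡⟨ cong₂ _+_ (u-coord b k) (sumS-coord k) ⟩
        coord b (toℕ k) + S (toℕ k)                        ≡⟨ step-coord (coordinate (FinP.toℕ<n k)) ⟩
        coord b′ (toℕ k) + Σℚ n (λ i → ℕℚ (a i) * E i (toℕ k)) ≡⟨ sym (cong₂ _+_ (u-coord b′ k)
                                                                     (Σℚ-cong n λ i _ → cong (ℕℚ (a i) *_) (e≡E i k))) ⟩
        u b′ k + Σᵥ n (λ i → ℕℚ (a i) ·ᵥ e i) k             ∎
        where open ≡-Reasoning

-- If s = 1 then q = (1), so L = 1 and p = (1), contradicting {p i} ∩ {q j} = ∅.
1<s : ∀ {r′ s′ L} (p q : ℕ → ℕ) → (∀ i → 1 ≤ i → i ≤ suc r′ → 0 < p i) →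
      (∀ i j → 1 ≤ i → i ≤ suc r′ → 1 ≤ j → j ≤ suc s′ → p i ≢ q j) → q (suc s′) ≡ 1 →
      sum (applyUpTo (λ i → p (suc i)) (suc r′)) ≡ L → sum (applyUpTo (λ j → q (suc j)) (suc s′)) ≡ L →
      1 < suc s′
1<s {s′ = suc _} _ _ _ _ _ _ _ = s≤s (s≤s z≤n)
1<s {r′} {zero} {L} p q p>0 p≢q q-last Σp≡L Σq≡L = ⊥-elim (p≢q 1 1 1≤1 (s≤s z≤n) 1≤1 1≤1 p₁≡q₁)
  where
  1≤1 : 1 ≤ 1
  1≤1 = ℕP.≤-refl
  L≡1 : L ≡ 1
  L≡1 = trans (sym Σq≡L) (trans (ℕP.+-identityʳ (q 1)) q-last)
  p₁≡q₁ : p 1 ≡ q 1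
  p₁≡q₁ = trans (ℕP.≤-antisym (subst (p 1 ≤_) (trans Σp≡L L≡1) (ℕP.m≤m+n (p 1) _)) (p>0 1 1≤1 (s≤s z≤n)))
                (sym q-last)

lemma4p1 : (r s : ℕ) → 1 ≤ r → 1 ≤ s → (p q : ℕ → ℕ) →
  (∀ i → 1 ≤ i → i ≤ r → 0 < p i) →
  (∀ j → 1 ≤ j → j ≤ s → 0 < q j) →
  (∀ i j → 1 ≤ i → i ≤ r → 1 ≤ j → j ≤ s → p i ≢ q j) →
  q s ≡ 1 →
  (L : ℕ) →
  sum (applyUpTo (λ i → p (suc i)) r) ≡ L →
  sum (applyUpTo (λ j → q (suc j)) s) ≡ L →
  let open Setup r s p q in
    (∀ b → b ∈ βlist → InG (u b) × Primitive (u b))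
  × (∀ b b′ → b ∈ βlist → b′ ∈ βlist → b ≢ b′ → ¬ (∀ k → u b k ≡ u b′ k))
  × ((bs : ℕ → ℚ) → bs 0 ≡ 0ℚ →
      (∀ i → 1 ≤ i → i ≤ L → bs (i ∸ 1) ℚ.≤ bs i) →
      applyUpTo (λ i → bs (suc i)) L ↭ βlist →
      ∀ i → 1 ≤ i → i ≤ L → bs (i ∸ 1) ℚ.< bs i →
      InTranslateH (u (bs i) +ᵥ sumS (bs i)) (u (bs (i ∸ 1))))
lemma4p1 (suc r′) (suc s′) _ _ p q p>0 q>0 p≢q q-last L Σp≡L Σq≡L =
  (λ b b∈β → u∈G bal (ℚP.<⇒≤ (proj₁ (β-bounds b∈β))) , β-primitive q>0 q-last 0<s′ b∈β) ,
  (λ b b′ → β-distinct q>0 q-last 0<s′) ,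
  λ bs bs₀≡0 bs-step enumerates i 1≤i i≤L bᵢ₋₁<bᵢ →
    let open SortedEnumeration bs bs-step enumerates in
    Consecutive.u+sumS∈u′+H q>0 bal (subst (ℚ._≤ bs (i ∸ 1)) bs₀≡0 (bs-mono z≤n (ℕP.≤-trans (ℕP.m∸n≤m i 1) i≤L)))
      bᵢ₋₁<bᵢ (proj₂ (β-bounds (bs∈ 1≤i i≤L))) (λ _ → nothing-between 1≤i i≤L)
  where
  open Setup (suc r′) (suc s′) p q
  open Configuration r′ s′ p q
  bal : Balance
  bal = balance q-last Σp≡L Σq≡L
  0<s′ : 0 < s′
  0<s′ = ℕP.≤-pred (1<s p q p>0 p≢q q-last Σp≡L Σq≡L)
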